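{- Let $0<m<n$ and let $J,J'\subsetneq\mathbb Z/n\mathbb Z$ with $J\cap J'\ne\emptyset$. Then $A_{u_J}A_{d_{J'}}=0$ and $A_{d_{J'}}A_{u_J}=0$ in $\mathbb A_{m,n}$.
   Context: $\widetilde S_n$ is the affine symmetric group with generators $s_i$, $i\in\mathbb Z/n\mathbb Z$. For $J\subsetneq\mathbb Z/n\mathbb Z$, $d_J$ (resp. $u_J$) is the element which is the product of the $s_j$, $j\in J$, each exactly once, with $s_{j+1}$ to the left of $s_j$ (resp. $s_j$ to the left of $s_{j+1}$) whenever $j,j+1\in J$ (cyclically decreasing, resp. increasing, elements). The affine nilCoxeter algebra $\mathbb A$ is generated over $\mathbb Z$ by $A_i$ ($i\in\mathbb Z/n\mathbb Z$) with $A_i^2=0$, $A_iA_{i+1}A_i=A_{i+1}A_iA_{i+1}$, $A_iA_j=A_jA_i$ for $i-j\ne\pm1$; $A_w=A_{i_1}\cdots A_{i_l}$ for a reduced word of $w$. $\mathbb A_{m,n}$ is the quotient of $\mathbb A$ by the two-sided ideal generated by all $A_iA_{i+1}A_i$, all $A_w$ with $w$ cyclically decreasing of length $>n-m$, and all $A_w$ with $w$ cyclically increasing of length $>m$. -}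

module Defs where

open import Data.Nat using (ℕ; zero; suc; _∸_; _<_)
open import Data.Nat.DivMod using (_mod_)
open import Data.Integer using (ℤ; _+_; _*_; -_; 1ℤ; 0ℤ)
open import Data.Fin using (Fin; toℕ)
import Data.Fin.Properties as FinP
open import Data.Fin.Subset using (Subset; _∈_; _∉_; ∣_∣)
open import Data.List using (List; []; _∷_; _++_; map)
import Data.List.Properties as ListP
import Data.List.Membership.Propositional as LM
open import Data.List.Relation.Unary.Unique.Propositional using (Unique)
open import Data.Product using (_×_; _,_; ∃; Σ)
open import Relation.Binary.PropositionalEquality using (_≡_; _≢_)
open import Relation.Nullary using (yes; no)
open import Function.Bundles using (_⇔_)

csuc : ∀ {n} → Fin n → Fin n
csuc {suc n} i = suc (toℕ i) mod suc n

Word : ℕ → Set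
Word n = List (Fin n)

-- elements of the free ℤ-algebra ℤ⟨A_0,…,A_{n-1}⟩ as formal ℤ-combinations of words
Poly : ℕ → Set
Poly n = List (ℤ × Word n)

_≟w_ : ∀ {n} (u v : Word n) → _
_≟w_ = ListP.≡-dec FinP._≟_

coeff : ∀ {n} → Poly n → Word n → ℤ
coeff [] w = 0ℤ
coeff ((c , v) ∷ p) w with v ≟w w
... | yes _ = c + coeff p w
... | no _ = coeff p w

mon : ∀ {n} → Word n → Poly n
mon w = (1ℤ , w) ∷ []

sandwich : ∀ {n} → Word n → Poly n → Word n → Poly n
sandwich u p v = map (λ { (c , w) → (c , u ++ w ++ v) }) p

scalePoly : ∀ {n} → ℤ → Poly n → Poly n
scalePoly a p = map (λ { (c , w) → (a * c , w) }) p

-- two-sided ideal of ℤ⟨A_i⟩ generated by a family G of elements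
data InIdeal {n} (G : Poly n → Set) : Poly n → Set where
  gen   : ∀ {g} → G g → (u v : Word n) → InIdeal G (sandwich u g v)
  nil   : InIdeal G []
  add   : ∀ {p q} → InIdeal G p → InIdeal G q → InIdeal G (p ++ q)
  scale : ∀ {p} (a : ℤ) → InIdeal G p → InIdeal G (scalePoly a p)
  ext   : ∀ {p q} → (∀ w → coeff p w ≡ coeff q w) → InIdeal G p → InIdeal G q

Before : ∀ {n} → Fin n → Fin n → Word n → Set
Before x y w = ∃ λ xs → ∃ λ ys → ∃ λ zs → w ≡ xs ++ x ∷ ys ++ y ∷ zs

Proper : ∀ {n} → Subset n → Set
Proper J = ∃ λ k → k ∉ J

-- w is a word using each s_j (j ∈ J) exactly once, s_{j+1} left of s_j when j,j+1 ∈ J: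
-- a (reduced) word for the cyclically decreasing element d_J
IsDecWord : ∀ {n} → Subset n → Word n → Set
IsDecWord J w = Unique w × (∀ j → (j LM.∈ w) ⇔ (j ∈ J))
              × (∀ j → j ∈ J → csuc j ∈ J → Before (csuc j) j w)

-- same for the cyclically increasing element u_J (s_j left of s_{j+1})
IsIncWord : ∀ {n} → Subset n → Word n → Set
IsIncWord J w = Unique w × (∀ j → (j LM.∈ w) ⇔ (j ∈ J))
              × (∀ j → j ∈ J → csuc j ∈ J → Before j (csuc j) w)

-- generators of the ideal defining 𝔸_{m,n} as a quotient of the free algebra
-- (nilCoxeter relations of 𝔸 together with the extra relations of 𝔸_{m,n})
data Gen (m n : ℕ) : Poly n → Set where
  nil2  : ∀ i → Gen m n (mon (i ∷ i ∷ []))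
  braid : ∀ i → Gen m n ((1ℤ , i ∷ csuc i ∷ i ∷ []) ∷ (- 1ℤ , csuc i ∷ i ∷ csuc i ∷ []) ∷ [])
  comm  : ∀ i j → i ≢ csuc j → j ≢ csuc i → Gen m n ((1ℤ , i ∷ j ∷ []) ∷ (- 1ℤ , j ∷ i ∷ []) ∷ [])
  iji   : ∀ i → Gen m n (mon (i ∷ csuc i ∷ i ∷ []))
  decL  : ∀ (J : Subset n) → Proper J → n ∸ m < ∣ J ∣ → ∀ w → IsDecWord J w → Gen m n (mon w)
  incL  : ∀ (J : Subset n) → Proper J → m < ∣ J ∣ → ∀ w → IsIncWord J w → Gen m n (mon w)

ZeroIn𝔸 : (m n : ℕ) → Word n → Set
ZeroIn𝔸 m n w = InIdeal (Gen m n) (mon w)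

module Submission where

-- Put I = J ∩ J′.  It is nonempty by hypothesis and misses an
-- index because J is proper, so going once around the cycle ℤ/nℤ we meet an
-- index k ∈ I with k+1 ∉ I, and an index d ∉ I with d+1 ∈ I.
--
-- For a·b (a a word for u_J, b a word for d_{J′}) look at the occurrence of
-- the letter k in a and the one in b.  A letter strictly between them is
-- never k-1: in a it would lie left of k (a is cyclically increasing), in b
-- right of k (b is cyclically decreasing).  The letter k+1 occurs there at
-- most once, since k+1 lies in at most one of J, J′.  Every other letter
-- commutes with A_k, so the two A_k's can be brought together, giving
-- A_k A_k = 0 or A_k A_{k+1} A_k = 0.  For b·a the same argument with
-- k = d+1 (now k+1 is the excluded letter and d the exceptional one) ends in
-- A_k A_k = 0 or A_{d+1} A_d A_{d+1} = 0.

open import Defs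
open import Data.Nat using (ℕ; suc; _<_; _≤_; _+_; _%_; s≤s; z≤n; NonZero)
open import Data.Nat.Properties using (+-comm; +-suc; ≤-trans; <⇒≤; m≤n+m; m≤n⇒m<n∨m≡n)
open import Data.Nat.DivMod using (_mod_; %-distribˡ-+; m%n%n≡m%n; [m+n]%n≡m%n; m<n⇒m%n≡m; m%n<n)
open import Data.Integer using (0ℤ; 1ℤ; -_) renaming (_+_ to _+ℤ_)
import Data.Integer.Properties as ℤ
open import Data.Fin using (Fin; toℕ; _≟_)
open import Data.Fin.Properties using (toℕ-injective; toℕ-fromℕ<; toℕ<n)
open import Data.Fin.Subset using (Subset; _∩_; Nonempty; _∈_; _∉_)
open import Data.Fin.Subset.Properties using (_∈?_; x∈p∩q⁺; x∈p∩q⁻)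
open import Data.List using (List; []; _∷_; _++_; [_])
open import Data.List.Properties using (++-assoc; ∷-injective)
open import Data.List.Relation.Unary.Any using (here; there)
open import Data.List.Relation.Unary.All using (All; []; _∷_; tabulate)
import Data.List.Relation.Unary.All.Properties as All
open import Data.List.Relation.Unary.AllPairs using ([]; _∷_)
open import Data.List.Relation.Unary.Unique.Propositional using (Unique)
open import Data.List.Relation.Unary.Unique.Propositional.Properties using (Unique[x∷xs]⇒x∉xs)
open import Data.List.Membership.Propositional using () renaming (_∈_ to _∈ₗ_; _∉_ to _∉ₗ_)
open import Data.List.Membership.Propositional.Properties using (∈-++⁺ˡ; ∈-++⁺ʳ; ∈-++⁻; ∈-∃++)
import Data.List.Membership.DecPropositional as DecMembership
open import Data.Product using (_×_; _,_; ∃; ∃₂; proj₁)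
open import Data.Sum using (_⊎_; inj₁; inj₂; [_,_]′)
open import Data.Empty using (⊥; ⊥-elim)
open import Function using (_∘_)
open import Function.Bundles using (Equivalence)
open import Relation.Binary.Definitions using (DecidableEquality)
open import Relation.Binary.PropositionalEquality using (_≡_; _≢_; refl; sym; trans; cong; subst; module ≡-Reasoning)
open import Relation.Nullary using (¬_; yes; no; ¬?)
open import Relation.Nullary.Decidable using (decidable-stable)
open import Relation.Unary using (Decidable)

open Equivalence using (to; from)

module _ {A : Set} where

  unique-disjoint : ∀ (x : List A) {y p} → Unique (x ++ y) → p ∈ₗ x → p ∈ₗ y → ⊥
  unique-disjoint (_ ∷ x) u (here refl) p∈y = Unique[x∷xs]⇒x∉xs u (∈-++⁺ʳ x p∈y)
  unique-disjoint (_ ∷ x) (_ ∷ u) (there p∈x) p∈y = unique-disjoint x u p∈x p∈y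

  unique-++ˡ : ∀ (x : List A) {y} → Unique (x ++ y) → Unique x
  unique-++ˡ [] _ = []
  unique-++ˡ (_ ∷ x) (q∉ ∷ u) = All.++⁻ˡ x q∉ ∷ unique-++ˡ x u

  unique-++ʳ : ∀ (x : List A) {y} → Unique (x ++ y) → Unique y
  unique-++ʳ [] u = u
  unique-++ʳ (_ ∷ x) (_ ∷ u) = unique-++ʳ x u

  unique-split : ∀ (x x′ : List A) {k y y′} → Unique (x ++ k ∷ y) →
                 x ++ k ∷ y ≡ x′ ++ k ∷ y′ → x ≡ x′ × y ≡ y′
  unique-split [] [] _ refl = refl , refl
  unique-split [] (_ ∷ x′) u refl = ⊥-elim (Unique[x∷xs]⇒x∉xs u (∈-++⁺ʳ x′ (here refl)))
  unique-split (_ ∷ x) [] u refl = ⊥-elim (Unique[x∷xs]⇒x∉xs u (∈-++⁺ʳ x (here refl)))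
  unique-split (_ ∷ x) (_ ∷ x′) (_ ∷ u) eq with refl , eq′ ← ∷-injective eq
    with refl , refl ← unique-split x x′ u eq′ = refl , refl

  AtMostOnce : A → List A → Set
  AtMostOnce e s = e ∉ₗ s ⊎ ∃₂ λ s₁ s₂ → s ≡ s₁ ++ e ∷ s₂ × e ∉ₗ s₁ × e ∉ₗ s₂

  unique⇒atMostOnce : DecidableEquality A → ∀ e {s} → Unique s → AtMostOnce e s
  unique⇒atMostOnce _≟ᴬ_ e {s} u with DecMembership._∈?_ _≟ᴬ_ e s
  ... | no e∉s = inj₁ e∉s
  ... | yes e∈s with s₁ , s₂ , refl ← ∈-∃++ e∈s =
    inj₂ (s₁ , s₂ , refl , (λ e∈s₁ → unique-disjoint s₁ u e∈s₁ (here refl))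
                         , Unique[x∷xs]⇒x∉xs (unique-++ʳ s₁ u))

  atMostOnce-++ˡ : ∀ {e} t {s} → e ∉ₗ t → AtMostOnce e s → AtMostOnce e (t ++ s)
  atMostOnce-++ˡ t e∉t (inj₁ e∉s) = inj₁ ([ e∉t , e∉s ]′ ∘ ∈-++⁻ t)
  atMostOnce-++ˡ {e} t e∉t (inj₂ (s₁ , s₂ , refl , e∉s₁ , e∉s₂)) =
    inj₂ (t ++ s₁ , s₂ , sym (++-assoc t s₁ (e ∷ s₂)) , [ e∉t , e∉s₁ ]′ ∘ ∈-++⁻ t , e∉s₂)

  atMostOnce-++ʳ : ∀ {e} t {s} → e ∉ₗ t → AtMostOnce e s → AtMostOnce e (s ++ t)
  atMostOnce-++ʳ t {s} e∉t (inj₁ e∉s) = inj₁ ([ e∉s , e∉t ]′ ∘ ∈-++⁻ s)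
  atMostOnce-++ʳ {e} t e∉t (inj₂ (s₁ , s₂ , refl , e∉s₁ , e∉s₂)) =
    inj₂ (s₁ , s₂ ++ t , ++-assoc s₁ (e ∷ s₂) t , e∉s₁ , [ e∉s₂ , e∉t ]′ ∘ ∈-++⁻ s₂)

module _ {n : ℕ} where

  before⇒∈prefix : ∀ x {k y p} → Unique (x ++ k ∷ y) → Before {n} p k (x ++ k ∷ y) → p ∈ₗ x
  before⇒∈prefix x {k} {p = p} u (xs , ys , zs , eq)
    with refl , _ ← unique-split x (xs ++ p ∷ ys) u (trans eq (sym (++-assoc xs (p ∷ ys) (k ∷ zs))))
    = ∈-++⁺ʳ xs (here refl)

  after⇒∈suffix : ∀ x {k y p} → Unique (x ++ k ∷ y) → Before {n} k p (x ++ k ∷ y) → p ∈ₗ y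
  after⇒∈suffix x u (xs , ys , zs , eq) with refl , refl ← unique-split x xs u eq =
    ∈-++⁺ʳ ys (here refl)

%-absorbʳ : ∀ a b d .{{_ : NonZero d}} → (a + b % d) % d ≡ (a + b) % d
%-absorbʳ a b d = begin
  (a + b % d) % d          ≡⟨ %-distribˡ-+ a (b % d) d ⟩
  (a % d + b % d % d) % d  ≡⟨ cong (λ r → (a % d + r) % d) (m%n%n≡m%n b d) ⟩
  (a % d + b % d) % d      ≡⟨ %-distribˡ-+ a b d ⟨
  (a + b) % d              ∎
  where open ≡-Reasoning

toℕ-mod : ∀ t n → toℕ (t mod suc n) ≡ t % suc n
toℕ-mod t n = toℕ-fromℕ< (m%n<n t (suc n))

mod-toℕ : ∀ {n} (i : Fin (suc n)) → toℕ i mod suc n ≡ i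
mod-toℕ {n} i = toℕ-injective (trans (toℕ-mod (toℕ i) n) (m<n⇒m%n≡m (toℕ<n i)))

mod-periodic : ∀ t n → (t + suc n) mod suc n ≡ t mod suc n
mod-periodic t n = toℕ-injective (begin
  toℕ ((t + suc n) mod suc n)  ≡⟨ toℕ-mod (t + suc n) n ⟩
  (t + suc n) % suc n          ≡⟨ [m+n]%n≡m%n t (suc n) ⟩
  t % suc n                    ≡⟨ toℕ-mod t n ⟨
  toℕ (t mod suc n)            ∎)
  where open ≡-Reasoning

csuc-mod : ∀ t n → csuc (t mod suc n) ≡ suc t mod suc n
csuc-mod t n = toℕ-injective (begin
  toℕ (csuc (t mod suc n))         ≡⟨ toℕ-mod (suc (toℕ (t mod suc n))) n ⟩
  suc (toℕ (t mod suc n)) % suc n  ≡⟨ cong (λ r → suc r % suc n) (toℕ-mod t n) ⟩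
  (1 + t % suc n) % suc n          ≡⟨ %-absorbʳ 1 t (suc n) ⟩
  suc t % suc n                    ≡⟨ toℕ-mod (suc t) n ⟨
  toℕ (suc t mod suc n)            ∎)
  where open ≡-Reasoning

csuc-retract : ∀ {n} (i : Fin (suc n)) → (n + toℕ (csuc i)) % suc n ≡ toℕ i
csuc-retract {n} i = begin
  (n + toℕ (csuc i)) % suc n         ≡⟨ cong (λ r → (n + r) % suc n) (toℕ-mod (suc (toℕ i)) n) ⟩
  (n + suc (toℕ i) % suc n) % suc n  ≡⟨ %-absorbʳ n (suc (toℕ i)) (suc n) ⟩
  (n + suc (toℕ i)) % suc n          ≡⟨ cong (_% suc n) (trans (+-comm n (suc (toℕ i))) (sym (+-suc (toℕ i) n))) ⟩
  (toℕ i + suc n) % suc n            ≡⟨ [m+n]%n≡m%n (toℕ i) (suc n) ⟩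
  toℕ i % suc n                      ≡⟨ m<n⇒m%n≡m (toℕ<n i) ⟩
  toℕ i                              ∎
  where open ≡-Reasoning

csuc-injective : ∀ {n} {i j : Fin n} → csuc i ≡ csuc j → i ≡ j
csuc-injective {suc n} {i} {j} eq = toℕ-injective (begin
  toℕ i                       ≡⟨ csuc-retract i ⟨
  (n + toℕ (csuc i)) % suc n  ≡⟨ cong (λ c → (n + toℕ c) % suc n) eq ⟩
  (n + toℕ (csuc j)) % suc n  ≡⟨ csuc-retract j ⟩
  toℕ j                       ∎)
  where open ≡-Reasoning

first-failure : ∀ (P : ℕ → Set) → Decidable P → ∀ {a b} → a ≤ b → P a → ¬ P b →
                ∃ λ t → P t × ¬ P (suc t)
first-failure P P? {b = 0} z≤n Pa ¬Pb = ⊥-elim (¬Pb Pa)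
first-failure P P? {a} {suc b} a≤1+b Pa ¬P1+b with P? b
... | yes Pb = b , Pb , ¬P1+b
... | no ¬Pb with m≤n⇒m<n∨m≡n a≤1+b
...   | inj₁ (s≤s a≤b) = first-failure P P? a≤b Pa ¬Pb
...   | inj₂ refl = ⊥-elim (¬P1+b Pa)

-- The same on the cycle ℤ/nℤ: a decidable property of residues holding at
-- i and failing at q holds at some k but not at k+1.  (Walk from i to q+n.)
boundary : ∀ {n} (P : Fin n → Set) → Decidable P → ∀ {i q} → P i → ¬ P q →
           ∃ λ k → P k × ¬ P (csuc k)
boundary {suc n} P P? {i} {q} Pi ¬Pq
  with t , Pt , ¬P1+t ← first-failure (P ∘ (_mod suc n)) (P? ∘ (_mod suc n))
                          (≤-trans (<⇒≤ (toℕ<n i)) (m≤n+m (suc n) (toℕ q)))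
                          (subst P (sym (mod-toℕ i)) Pi)
                          (¬Pq ∘ subst P (trans (mod-periodic (toℕ q) n) (mod-toℕ q)))
  = t mod suc n , Pt , ¬P1+t ∘ subst P (csuc-mod t n)

coeff-match : ∀ {n c} {v w : Word n} {p} → v ≡ w → coeff ((c , v) ∷ p) w ≡ c +ℤ coeff p w
coeff-match {v = v} {w} v≡w with v ≟w w
... | yes _ = refl
... | no v≢w = ⊥-elim (v≢w v≡w)

coeff-miss : ∀ {n c} {v w : Word n} {p} → v ≢ w → coeff ((c , v) ∷ p) w ≡ coeff p w
coeff-miss {v = v} {w} v≢w with v ≟w w
... | yes v≡w = ⊥-elim (v≢w v≡w)
... | no _ = refl

coeff-cancel : ∀ {n} (v : Word n) (p : Poly n) w → coeff ((1ℤ , v) ∷ (- 1ℤ , v) ∷ p) w ≡ coeff p w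
coeff-cancel v p w with v ≟w w
... | yes v≡w = begin
  1ℤ +ℤ coeff ((- 1ℤ , v) ∷ p) w  ≡⟨ cong (1ℤ +ℤ_) (coeff-match v≡w) ⟩
  1ℤ +ℤ (- 1ℤ +ℤ coeff p w)       ≡⟨ ℤ.+-assoc 1ℤ (- 1ℤ) (coeff p w) ⟨
  0ℤ +ℤ coeff p w                 ≡⟨ ℤ.+-identityˡ (coeff p w) ⟩
  coeff p w                       ∎
  where open ≡-Reasoning
... | no v≢w = coeff-miss v≢w

-- A_k and A_p commute: p is not a cyclic neighbour of k.
Apart : ∀ {n} → Fin n → Fin n → Set
Apart k p = p ≢ csuc k × k ≢ csuc p

module Vanishing (m n : ℕ) where

  Zero : Word n → Set
  Zero = ZeroIn𝔸 m n

  replace : ∀ {v w} → Zero v → InIdeal (Gen m n) ((1ℤ , v) ∷ (- 1ℤ , w) ∷ []) → Zero w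
  replace {v} {w} zv v≡w = ext (coeff-cancel v ((1ℤ , w) ∷ [])) (add zv (scale (- 1ℤ) v≡w))

  -- The relations used: A_i A_j = A_j A_i for non-neighbours, A_i² = 0,
  -- A_i A_{i+1} A_i = 0, and (by the braid relation) A_{i+1} A_i A_{i+1} = 0.
  swap : ∀ u v {i j} → i ≢ csuc j → j ≢ csuc i → Zero (u ++ i ∷ j ∷ v) → Zero (u ++ j ∷ i ∷ v)
  swap u v {i} {j} i≢1+j j≢1+i z = replace z (gen (comm i j i≢1+j j≢1+i) u v)

  vanish-ii : ∀ u v i → Zero (u ++ i ∷ i ∷ v)
  vanish-ii u v i = gen (nil2 i) u v

  vanish-iji : ∀ i u v → Zero (u ++ i ∷ csuc i ∷ i ∷ v)
  vanish-iji i u v = gen (iji i) u v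

  vanish-jij : ∀ i u v → Zero (u ++ csuc i ∷ i ∷ csuc i ∷ v)
  vanish-jij i u v = replace (gen (iji i) u v) (gen (braid i) u v)

  move-left : ∀ {k} y → All (Apart k) y → ∀ u v → Zero (u ++ y ++ k ∷ v) → Zero (u ++ k ∷ y ++ v)
  move-left [] [] u v z = z
  move-left (q ∷ y) ((q≢1+k , k≢1+q) ∷ apart) u v z =
    swap u (y ++ v) q≢1+k k≢1+q
      (subst Zero (++-assoc u [ q ] _)
        (move-left y apart (u ++ [ q ]) v (subst Zero (sym (++-assoc u [ q ] _)) z)))

  move-right : ∀ {k} y → All (Apart k) y → ∀ u v → Zero (u ++ k ∷ y ++ v) → Zero (u ++ y ++ k ∷ v)
  move-right [] [] u v z = z
  move-right (q ∷ y) ((q≢1+k , k≢1+q) ∷ apart) u v z =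
    subst Zero (++-assoc u [ q ] _)
      (move-right y apart (u ++ [ q ]) v
        (subst Zero (sym (++-assoc u [ q ] _)) (swap u (y ++ v) k≢1+q q≢1+k z)))

  vanish-between : ∀ {k e} → (∀ u v → Zero (u ++ k ∷ e ∷ k ∷ v)) → ∀ x s w →
                   (∀ {p} → p ∈ₗ s → p ≢ e → Apart k p) → AtMostOnce e s →
                   Zero (x ++ k ∷ s ++ k ∷ w)
  vanish-between {k} {e} kek x s w apart once = from-once once
    where
    apart-on : ∀ t → (∀ {p} → p ∈ₗ t → p ∈ₗ s) → e ∉ₗ t → All (Apart k) t
    apart-on t t⊆s e∉t = tabulate λ p∈t → apart (t⊆s p∈t) λ { refl → e∉t p∈t }

    from-once : AtMostOnce e s → Zero (x ++ k ∷ s ++ k ∷ w)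
    from-once (inj₁ e∉s) =
      move-left s (apart-on s (λ p∈s → p∈s) e∉s) x (k ∷ w)
        (subst Zero (++-assoc x s _) (vanish-ii (x ++ s) w k))
    from-once (inj₂ (s₁ , s₂ , refl , e∉s₁ , e∉s₂)) =
      subst Zero (cong (λ t → x ++ k ∷ t) (sym (++-assoc s₁ (e ∷ s₂) (k ∷ w)))) k-left
      where
      kek-middle : Zero (((x ++ s₁) ++ k ∷ e ∷ []) ++ k ∷ s₂ ++ w)
      kek-middle = subst Zero (sym (++-assoc (x ++ s₁) (k ∷ e ∷ []) _)) (kek (x ++ s₁) (s₂ ++ w))

      k-right : Zero (x ++ s₁ ++ k ∷ e ∷ s₂ ++ k ∷ w)
      k-right = subst Zero (trans (++-assoc (x ++ s₁) (k ∷ e ∷ []) _) (++-assoc x s₁ _))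
                  (move-right s₂ (apart-on s₂ (∈-++⁺ʳ s₁ ∘ there) e∉s₂) _ w kek-middle)

      k-left : Zero (x ++ k ∷ s₁ ++ e ∷ s₂ ++ k ∷ w)
      k-left = move-left s₁ (apart-on s₁ ∈-++⁺ˡ e∉s₁) x _ k-right

  vanish-across : ∀ {k e} (Q : Fin n → Set) → (∀ u v → Zero (u ++ k ∷ e ∷ k ∷ v)) →
                  (∀ {p} → p ≢ e → ¬ Q p → Apart k p) →
                  ∀ x y z w → Unique (x ++ k ∷ y) → Unique (z ++ k ∷ w) →
                  (∀ {p} → Q p → p ∈ₗ x ++ k ∷ y → Before p k (x ++ k ∷ y)) →
                  (∀ {p} → Q p → p ∈ₗ z ++ k ∷ w → Before k p (z ++ k ∷ w)) →
                  e ∉ₗ y ⊎ e ∉ₗ z →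
                  Zero ((x ++ k ∷ y) ++ z ++ k ∷ w)
  vanish-across {k} {e} Q kek neighbours x y z w uL uR Q-left Q-right e∉y⊎e∉z =
    subst Zero reassociate (vanish-between kek x (y ++ z) w apart (once e∉y⊎e∉z))
    where
    reassociate : x ++ k ∷ (y ++ z) ++ k ∷ w ≡ (x ++ k ∷ y) ++ z ++ k ∷ w
    reassociate = trans (cong (λ t → x ++ k ∷ t) (++-assoc y z (k ∷ w))) (sym (++-assoc x (k ∷ y) _))

    ¬Q : ∀ {p} → p ∈ₗ y ++ z → ¬ Q p
    ¬Q {p} p∈yz Qp with ∈-++⁻ y p∈yz
    ... | inj₁ p∈y = unique-disjoint x uL (before⇒∈prefix x uL (Q-left Qp (∈-++⁺ʳ x (there p∈y)))) (there p∈y)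
    ... | inj₂ p∈z = unique-disjoint z uR p∈z (there (after⇒∈suffix z uR (Q-right Qp (∈-++⁺ˡ p∈z))))

    apart : ∀ {p} → p ∈ₗ y ++ z → p ≢ e → Apart k p
    apart p∈yz p≢e = neighbours p≢e (¬Q p∈yz)

    unique-y : Unique y
    unique-y with _ ∷ u ← unique-++ʳ x uL = u

    once : e ∉ₗ y ⊎ e ∉ₗ z → AtMostOnce e (y ++ z)
    once (inj₁ e∉y) = atMostOnce-++ˡ y e∉y (unique⇒atMostOnce _≟_ e (unique-++ˡ z uR))
    once (inj₂ e∉z) = atMostOnce-++ʳ z e∉z (unique⇒atMostOnce _≟_ e unique-y)

module _ {m n : ℕ} {J J′ : Subset n} where

  open Vanishing m n

  -- With k ∈ J ∩ J′ and k+1 ∉ J ∩ J′, the two k's of A_{u_J} A_{d_{J′}} meet;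
  -- k-1 is the Q-letter and k+1 the exceptional letter.
  inc-dec-vanishes : ∀ {k} → k ∈ J ∩ J′ → csuc k ∉ J ∩ J′ →
                     ∀ a b → IsIncWord J a → IsDecWord J′ b → Zero (a ++ b)
  inc-dec-vanishes {k} k∈I 1+k∉I a b (ua , ma , oa) (ub , mb , ob)
    with k∈J , k∈J′ ← x∈p∩q⁻ J J′ k∈I
    with x , y , refl ← ∈-∃++ (from (ma k) k∈J)
    with z , w , refl ← ∈-∃++ (from (mb k) k∈J′)
    = vanish-across (λ p → csuc p ≡ k) (vanish-iji k) neighbours x y z w ua ub Q-left Q-right once
    where
    neighbours : ∀ {p} → p ≢ csuc k → csuc p ≢ k → Apart k p
    neighbours p≢1+k 1+p≢k = p≢1+k , 1+p≢k ∘ sym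

    Q-left : ∀ {p} → csuc p ≡ k → p ∈ₗ x ++ k ∷ y → Before p k (x ++ k ∷ y)
    Q-left {p} 1+p≡k p∈a =
      subst (λ c → Before p c _) 1+p≡k (oa p (to (ma p) p∈a) (subst (_∈ J) (sym 1+p≡k) k∈J))

    Q-right : ∀ {p} → csuc p ≡ k → p ∈ₗ z ++ k ∷ w → Before k p (z ++ k ∷ w)
    Q-right {p} 1+p≡k p∈b =
      subst (λ c → Before c p _) 1+p≡k (ob p (to (mb p) p∈b) (subst (_∈ J′) (sym 1+p≡k) k∈J′))

    once : csuc k ∉ₗ y ⊎ csuc k ∉ₗ z
    once with csuc k ∈? J
    ... | yes 1+k∈J = inj₂ λ 1+k∈z → 1+k∉I (x∈p∩q⁺ (1+k∈J , to (mb _) (∈-++⁺ˡ 1+k∈z)))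
    ... | no 1+k∉J = inj₁ λ 1+k∈y → 1+k∉J (to (ma _) (∈-++⁺ʳ x (there 1+k∈y)))

  -- With d ∉ J ∩ J′ and k = d+1 ∈ J ∩ J′, the two k's of A_{d_{J′}} A_{u_J}
  -- meet; k+1 is the Q-letter and d the exceptional letter.
  dec-inc-vanishes : ∀ {d} → d ∉ J ∩ J′ → csuc d ∈ J ∩ J′ →
                     ∀ a b → IsIncWord J a → IsDecWord J′ b → Zero (b ++ a)
  dec-inc-vanishes {d} d∉I k∈I a b (ua , ma , oa) (ub , mb , ob)
    with k∈J , k∈J′ ← x∈p∩q⁻ J J′ k∈I
    with x , y , refl ← ∈-∃++ (from (ma (csuc d)) k∈J)
    with z , w , refl ← ∈-∃++ (from (mb (csuc d)) k∈J′)
    = vanish-across (λ p → p ≡ csuc k) (vanish-jij d) neighbours z w x y ub ua Q-left Q-right once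
    where
    k : Fin n
    k = csuc d

    neighbours : ∀ {p} → p ≢ d → p ≢ csuc k → Apart k p
    neighbours p≢d p≢1+k = p≢1+k , λ k≡1+p → p≢d (csuc-injective (sym k≡1+p))

    Q-left : ∀ {p} → p ≡ csuc k → p ∈ₗ z ++ k ∷ w → Before p k (z ++ k ∷ w)
    Q-left refl p∈b = ob k k∈J′ (to (mb _) p∈b)

    Q-right : ∀ {p} → p ≡ csuc k → p ∈ₗ x ++ k ∷ y → Before k p (x ++ k ∷ y)
    Q-right refl p∈a = oa k k∈J (to (ma _) p∈a)

    once : d ∉ₗ w ⊎ d ∉ₗ x
    once with d ∈? J
    ... | yes d∈J = inj₁ λ d∈w → d∉I (x∈p∩q⁺ (d∈J , to (mb d) (∈-++⁺ʳ z (there d∈w))))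
    ... | no d∉J = inj₂ λ d∈x → d∉J (to (ma d) (∈-++⁺ˡ d∈x))

-- The boundary of J ∩ J′ on the cycle supplies the letters k and d above.
lemma5 : ∀ {m n : ℕ} → 0 < m → m < n → (J J′ : Subset n) → Proper J → Proper J′
       → Nonempty (J ∩ J′) → ∀ a b → IsIncWord J a → IsDecWord J′ b
       → ZeroIn𝔸 m n (a ++ b) × ZeroIn𝔸 m n (b ++ a)
lemma5 {m} {n} _ _ J J′ (q , q∉J) _ (i , i∈I) a b inc dec = a-b-vanishes , b-a-vanishes
  where
  q∉I : q ∉ J ∩ J′
  q∉I = q∉J ∘ proj₁ ∘ x∈p∩q⁻ J J′

  a-b-vanishes : ZeroIn𝔸 m n (a ++ b)
  a-b-vanishes with k , k∈I , 1+k∉I ← boundary (_∈ J ∩ J′) (_∈? J ∩ J′) i∈I q∉I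
    = inc-dec-vanishes k∈I 1+k∉I a b inc dec

  b-a-vanishes : ZeroIn𝔸 m n (b ++ a)
  b-a-vanishes with d , d∉I , ¬1+d∉I ← boundary (_∉ J ∩ J′) (¬? ∘ (_∈? J ∩ J′)) q∉I (λ i∉I → i∉I i∈I)
    = dec-inc-vanishes d∉I (decidable-stable (csuc d ∈? J ∩ J′) ¬1+d∉I) a b inc dec
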